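{- Let $\Gamma$ be a tree and $A:\mathcal{U}$. Then the function $[\mathrm{id}_A]_{i:\Gamma_0}:\mathrm{colim}_\Gamma A\to A$ is an equivalence.
   Context: Work in homotopy type theory. Graphs and trees. A graph $\Gamma$ consists of $\Gamma_0:\mathcal{U}$ and $\Gamma_1:\Gamma_0\to\Gamma_0\to\mathcal{U}$. Its geometric realization is the higher inductive type with points $|i|$ and paths $|i|=|j|$ for each $g:\Gamma_1(i,j)$. $\Gamma$ is a tree if its geometric realization is contractible. Colimits. $\mathrm{colim}_\Gamma A$ is the colimit of the constant diagram over $\Gamma$ at $A$ (all edge maps $\mathrm{id}_A$). It is the higher inductive type with - constructors $\iota_i:A\to\mathrm{colim}_\Gamma A$ for $i:\Gamma_0$, - paths $\kappa_{i,j,g}(a):\iota_j(a)=\iota_i(a)$. The map $[\mathrm{id}_A]$ is defined by $\iota_i(a)\mapsto a$ and $\kappa_{i,j,g}(a)\mapsto\mathsf{refl}_a$. -}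

{-# OPTIONS --without-K #-}
module Defs where

open import Level using (Level; _⊔_) renaming (suc to lsuc)
open import Data.Product using (Σ; _,_; proj₁)
open import Relation.Binary.PropositionalEquality
  using (_≡_; refl; sym; trans; cong; subst)

isContr : ∀ {ℓ} → Set ℓ → Set ℓ
isContr X = Σ X λ c → ∀ x → c ≡ x

fiber : ∀ {ℓ ℓ'} {X : Set ℓ} {Y : Set ℓ'} → (X → Y) → Y → Set (ℓ ⊔ ℓ')
fiber {X = X} f y = Σ X λ x → f x ≡ y

isEquiv : ∀ {ℓ ℓ'} {X : Set ℓ} {Y : Set ℓ'} → (X → Y) → Set (ℓ ⊔ ℓ')
isEquiv f = ∀ y → isContr (fiber f y)

apd : ∀ {ℓ ℓ'} {X : Set ℓ} (P : X → Set ℓ') (f : ∀ x → P x) {x y : X}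
      (p : x ≡ y) → subst P p (f x) ≡ f y
apd P f refl = refl

subst-const : ∀ {ℓ ℓ'} {X : Set ℓ} {B : Set ℓ'} {x y : X} (p : x ≡ y) (b : B) →
              subst (λ _ → B) p b ≡ b
subst-const refl b = refl

record Graph (ℓ : Level) : Set (lsuc ℓ) where
  field
    Γ₀ : Set ℓ
    Γ₁ : Γ₀ → Γ₀ → Set ℓ
open Graph public

-- The geometric realization of a graph, presented as a type together with
-- its constructors and dependent eliminator (with computation rules):
-- points |i| for i : Γ₀ and paths |i| = |j| for g : Γ₁ i j.
record Realization {ℓ : Level} (Γ : Graph ℓ) : Set (lsuc ℓ) where
  field
    Carrier : Set ℓ
    pt      : Γ₀ Γ → Carrier
    edge    : ∀ {i j} → Γ₁ Γ i j → pt i ≡ pt j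
    ind     : (P : Carrier → Set ℓ) (p : ∀ i → P (pt i))
              (e : ∀ i j (g : Γ₁ Γ i j) → subst P (edge g) (p i) ≡ p j) →
              ∀ x → P x
    ind-pt  : ∀ P p e i → ind P p e (pt i) ≡ p i
    ind-edge : ∀ P p e {i j} (g : Γ₁ Γ i j) →
               apd P (ind P p e) (edge g)
                 ≡ trans (cong (subst P (edge g)) (ind-pt P p e i))
                         (trans (e i j g) (sym (ind-pt P p e j)))

isTree : ∀ {ℓ} {Γ : Graph ℓ} → Realization Γ → Set ℓ
isTree R = isContr (Realization.Carrier R)

-- The colimit of the constant diagram over Γ at A (edge maps id_A):
-- ι i : A → colim, κ g a : ι j a = ι i a for g : Γ₁ i j.
record ConstColim {ℓ : Level} (Γ : Graph ℓ) (A : Set ℓ) : Set (lsuc ℓ) where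
  field
    Carrier : Set ℓ
    ι       : Γ₀ Γ → A → Carrier
    κ       : ∀ {i j} → Γ₁ Γ i j → ∀ a → ι j a ≡ ι i a
    ind     : (P : Carrier → Set ℓ) (p : ∀ i a → P (ι i a))
              (e : ∀ i j (g : Γ₁ Γ i j) a → subst P (κ g a) (p j a) ≡ p i a) →
              ∀ x → P x
    ind-ι   : ∀ P p e i a → ind P p e (ι i a) ≡ p i a
    ind-κ   : ∀ P p e {i j} (g : Γ₁ Γ i j) a →
              apd P (ind P p e) (κ g a)
                ≡ trans (cong (subst P (κ g a)) (ind-ι P p e j a))
                        (trans (e i j g a) (sym (ind-ι P p e i a)))

idMap : ∀ {ℓ} {Γ : Graph ℓ} {A : Set ℓ} (C : ConstColim Γ A) →
        ConstColim.Carrier C → A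
idMap {A = A} C =
  ConstColim.ind C (λ _ → A) (λ i a → a) (λ i j g a → subst-const (ConstColim.κ C g a) a)

{-# OPTIONS --without-K #-}
-- colim_Γ A is |Γ| × A, so each a : A gives a map  slice a : |Γ| → colim_Γ A
-- with |i| ↦ ι i a, and the inverse of [id_A] is a ↦ slice a evaluated at the
-- centre of the contractible |Γ|. That [id_A] ∘ slice a is constant at a is an
-- induction on |Γ|; the other composite is an induction on the colimit, where
-- the contraction of |Γ| yields paths  slice a centre = ι i a  compatible with κ.
module Submission where

open import Level using (Level)
open import Function using (_∘_; id; const)
open import Data.Product using (_,_; proj₁; proj₂)
open import Data.Product.Properties using (Σ-≡,≡→≡)
open import Relation.Binary.PropositionalEquality
  using (_≡_; refl; sym; trans; cong; subst; naturality; cong-≡id; module ≡-Reasoning)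
open import Relation.Binary.PropositionalEquality.Properties
  using (trans-reflʳ; trans-assoc; trans-symˡ; cong-id; cong-∘; trans-cong)
open import Defs

private
  variable
    a b c : Level
    X : Set a
    Y : Set b
    Z : Set c

cong-const : ∀ {x y : X} {w : Y} (p : x ≡ y) → cong (const w) p ≡ refl
cong-const refl = refl

contraction-trans : ∀ {x₀ : X} (φ : ∀ x → x₀ ≡ x) {x y : X} (p : x ≡ y) →
                    φ y ≡ trans (φ x) p
contraction-trans φ {x} refl = sym (trans-reflʳ (φ x))

subst-homotopy : ∀ {k l : X → Y} {x y : X} (p : x ≡ y)
                 {u : k x ≡ l x} {v : k y ≡ l y} →
                 trans (cong k p) v ≡ trans u (cong l p) →
                 subst (λ z → k z ≡ l z) p u ≡ v
subst-homotopy refl {u} square = sym (trans square (trans-reflʳ u))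

cong-from-apd : ∀ (f : X → Y) {x y : X} (p : x ≡ y) {u v : Y}
                (β : f x ≡ u) (β′ : f y ≡ v) {E : subst (λ _ → Y) p u ≡ v} (q : u ≡ v) →
                E ≡ trans (subst-const p u) q →
                apd (λ _ → Y) f p ≡ trans (cong (subst (λ _ → Y) p) β) (trans E (sym β′)) →
                cong f p ≡ trans β (trans q (sym β′))
cong-from-apd f refl β β′ q refl apd-rule =
  trans apd-rule (cong (λ r → trans r (trans q (sym β′))) (cong-id β))

cong-conjugate-square : ∀ (h : Y → Z) {s t u v : Y} {w : Z}
                        {d : s ≡ t} {β : s ≡ u} {q : v ≡ u} {β′ : t ≡ v}
                        {γ : h u ≡ w} {γ′ : h v ≡ w} →
                        d ≡ trans β (trans (sym q) (sym β′)) →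
                        cong h q ≡ trans γ′ (sym γ) →
                        trans (cong h d) (trans (cong h β′) γ′) ≡ trans (cong h β) γ
cong-conjugate-square h {β = refl} {refl} {refl} {refl} {γ′} refl hq =
  sym (trans hq (trans-reflʳ γ′))

trans-conjugate-cancel : ∀ {s t u v w : X} (m : s ≡ t) (β : t ≡ u) (q : v ≡ u) (β′ : w ≡ v) →
                         trans (trans (trans m (trans β (trans (sym q) (sym β′)))) β′) q
                           ≡ trans m β
trans-conjugate-cancel refl refl refl refl = refl

cong-whisker-square : ∀ (h : Y → Z) {s t u : Y} {w w′ : Z}
                      (p : s ≡ u) (p′ : t ≡ u) {r′ : h u ≡ w′} {k : w′ ≡ w} {r : h u ≡ w} →
                      trans r′ k ≡ r →
                      trans (cong h (trans p′ (sym p))) (trans (cong h p) r)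
                        ≡ trans (trans (cong h p′) r′) k
cong-whisker-square h refl refl refl = refl

qinv⇒isEquiv : ∀ (f : X → Y) (g : Y → X) →
               (∀ x → g (f x) ≡ x) → (∀ y → f (g y) ≡ y) → isEquiv f
qinv⇒isEquiv f g η ε y = (g y , ε′ y) , centre-unique
  where
  open ≡-Reasoning

  -- the half-adjoint correction of ε, coherent with η
  ε′ : ∀ y → f (g y) ≡ y
  ε′ y = trans (sym (ε (f (g y)))) (trans (cong f (η (g y))) (ε y))

  triangle : ∀ x → ε′ (f x) ≡ cong f (η x)
  triangle x = begin
    trans (sym (ε (f (g (f x))))) (trans (cong f (η (g (f x)))) (ε (f x)))
      ≡⟨ cong (λ r → trans (sym (ε (f (g (f x))))) (trans r (ε (f x)))) f-η-gf ⟩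
    trans (sym (ε (f (g (f x))))) (trans (cong (f ∘ g) (cong f (η x))) (ε (f x)))
      ≡⟨ cong (trans (sym (ε (f (g (f x)))))) (naturality ε) ⟩
    trans (sym (ε (f (g (f x))))) (trans (ε (f (g (f x)))) (cong id (cong f (η x))))
      ≡⟨ sym (trans-assoc (sym (ε (f (g (f x)))))) ⟩
    trans (trans (sym (ε (f (g (f x))))) (ε (f (g (f x))))) (cong id (cong f (η x)))
      ≡⟨ cong (λ r → trans r (cong id (cong f (η x)))) (trans-symˡ (ε (f (g (f x))))) ⟩
    cong id (cong f (η x))
      ≡⟨ cong-id (cong f (η x)) ⟩
    cong f (η x) ∎
    where
    f-η-gf : cong f (η (g (f x))) ≡ cong (f ∘ g) (cong f (η x))
    f-η-gf = begin
      cong f (η (g (f x)))           ≡⟨ cong (cong f) (sym (cong-≡id η)) ⟩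
      cong f (cong (g ∘ f) (η x))    ≡⟨ sym (cong-∘ (η x)) ⟩
      cong (f ∘ g ∘ f) (η x)         ≡⟨ cong-∘ (η x) ⟩
      cong (f ∘ g) (cong f (η x))    ∎

  centre-unique : ∀ {y} (w : fiber f y) → (g y , ε′ y) ≡ w
  centre-unique (x , refl) = Σ-≡,≡→≡ (η x , subst-homotopy (η x) (begin
    trans (cong f (η x)) refl              ≡⟨ cong (λ r → trans r refl) (sym (triangle x)) ⟩
    trans (ε′ (f x)) refl                  ≡⟨ cong (trans (ε′ (f x))) (sym (cong-const (η x))) ⟩
    trans (ε′ (f x)) (cong (const (f x)) (η x)) ∎))

module RealizationProperties {ℓ} {Γ : Graph ℓ} (R : Realization Γ) {B : Set ℓ} where
  open Realization R

  rec : (p : Γ₀ Γ → B) → (∀ {i j} → Γ₁ Γ i j → p i ≡ p j) → Carrier → B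
  rec p e = ind (λ _ → B) p (λ i j g → trans (subst-const (edge g) (p i)) (e g))

  module _ (p : Γ₀ Γ → B) (e : ∀ {i j} → Γ₁ Γ i j → p i ≡ p j) where

    rec-pt : ∀ i → rec p e (pt i) ≡ p i
    rec-pt = ind-pt (λ _ → B) p (λ i j g → trans (subst-const (edge g) (p i)) (e g))

    rec-edge : ∀ {i j} (g : Γ₁ Γ i j) →
               cong (rec p e) (edge g) ≡ trans (rec-pt i) (trans (e g) (sym (rec-pt j)))
    rec-edge g = cong-from-apd (rec p e) (edge g) (rec-pt _) (rec-pt _) (e g) refl
                   (ind-edge _ _ _ g)

  homotopy : (k l : Carrier → B) (H : ∀ i → k (pt i) ≡ l (pt i)) →
             (∀ {i j} (g : Γ₁ Γ i j) →
                trans (cong k (edge g)) (H j) ≡ trans (H i) (cong l (edge g))) →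
             ∀ x → k x ≡ l x
  homotopy k l H square = ind (λ x → k x ≡ l x) H (λ i j g → subst-homotopy (edge g) (square g))

module ConstColimProperties {ℓ} {Γ : Graph ℓ} {A : Set ℓ} (C : ConstColim Γ A) where
  open ConstColim C

  idMap-ι : ∀ i a → idMap C (ι i a) ≡ a
  idMap-ι = ind-ι (λ _ → A) (λ _ a → a) (λ _ _ g a → subst-const (κ g a) a)

  idMap-κ : ∀ {i j} (g : Γ₁ Γ i j) a →
            cong (idMap C) (κ g a) ≡ trans (idMap-ι j a) (sym (idMap-ι i a))
  idMap-κ {i} {j} g a = cong-from-apd (idMap C) (κ g a) (idMap-ι j a) (idMap-ι i a) refl
                          (sym (trans-reflʳ _))
                  (ind-κ _ _ _ g a)

  homotopy : ∀ {B : Set ℓ} (k l : Carrier → B) (H : ∀ i a → k (ι i a) ≡ l (ι i a)) →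
             (∀ {i j} (g : Γ₁ Γ i j) a →
                trans (cong k (κ g a)) (H i a) ≡ trans (H j a) (cong l (κ g a))) →
             ∀ x → k x ≡ l x
  homotopy k l H square =
    ind (λ x → k x ≡ l x) H (λ i j g a → subst-homotopy (κ g a) (square g a))

module _ {ℓ} {Γ : Graph ℓ} (R : Realization Γ) (tree : isTree R)
         {A : Set ℓ} (C : ConstColim Γ A) where
  open Realization R using (pt; edge) renaming (Carrier to |Γ|)
  open ConstColim C using (ι; κ) renaming (Carrier to colim)
  module Real = RealizationProperties R
  module Colim = ConstColimProperties C
  open ≡-Reasoning

  slice : A → |Γ| → colim
  slice a = Real.rec (λ i → ι i a) (λ g → sym (κ g a))

  slice-pt : ∀ a i → slice a (pt i) ≡ ι i a
  slice-pt a = Real.rec-pt _ _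

  slice-edge : ∀ a {i j} (g : Γ₁ Γ i j) →
               cong (slice a) (edge g)
                 ≡ trans (slice-pt a i) (trans (sym (κ g a)) (sym (slice-pt a j)))
  slice-edge a = Real.rec-edge _ _

  centre : |Γ|
  centre = proj₁ tree

  contraction : ∀ x → centre ≡ x
  contraction = proj₂ tree

  inverse : A → colim
  inverse a = slice a centre

  idMap∘slice : ∀ a x → idMap C (slice a x) ≡ a
  idMap∘slice a = Real.homotopy (idMap C ∘ slice a) (const a) H λ {i} {j} g → begin
    trans (cong (idMap C ∘ slice a) (edge g)) (H j)
      ≡⟨ cong (λ r → trans r (H j)) (cong-∘ (edge g)) ⟩
    trans (cong (idMap C) (cong (slice a) (edge g))) (H j)
      ≡⟨ cong-conjugate-square (idMap C) {β = slice-pt a i} {β′ = slice-pt a j}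
                               (slice-edge a g) (Colim.idMap-κ g a) ⟩
    H i
      ≡⟨ sym (trans-reflʳ (H i)) ⟩
    trans (H i) refl
      ≡⟨ cong (trans (H i)) (sym (cong-const (edge g))) ⟩
    trans (H i) (cong (const a) (edge g)) ∎
    where
    H : ∀ i → idMap C (slice a (pt i)) ≡ a
    H i = trans (cong (idMap C) (slice-pt a i)) (Colim.idMap-ι i a)

  inverse-to-ι : ∀ i a → inverse a ≡ ι i a
  inverse-to-ι i a = trans (cong (slice a) (contraction (pt i))) (slice-pt a i)

  inverse-to-ι-κ : ∀ {i j} (g : Γ₁ Γ i j) a →
                   trans (inverse-to-ι j a) (κ g a) ≡ inverse-to-ι i a
  inverse-to-ι-κ {i} {j} g a = begin
    trans (trans (cong (slice a) (contraction (pt j))) (slice-pt a j)) (κ g a)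
      ≡⟨ cong (λ r → trans (trans (cong (slice a) r) (slice-pt a j)) (κ g a))
              (contraction-trans contraction (edge g)) ⟩
    trans (trans (cong (slice a) (trans (contraction (pt i)) (edge g))) (slice-pt a j)) (κ g a)
      ≡⟨ cong (λ r → trans (trans r (slice-pt a j)) (κ g a))
              (sym (trans-cong (contraction (pt i)))) ⟩
    trans (trans (trans (cong (slice a) (contraction (pt i))) (cong (slice a) (edge g)))
                 (slice-pt a j)) (κ g a)
      ≡⟨ cong (λ r → trans (trans (trans (cong (slice a) (contraction (pt i))) r)
                                  (slice-pt a j)) (κ g a))
              (slice-edge a g) ⟩
    trans (trans (trans (cong (slice a) (contraction (pt i)))
                        (trans (slice-pt a i) (trans (sym (κ g a)) (sym (slice-pt a j)))))
                 (slice-pt a j)) (κ g a)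
      ≡⟨ trans-conjugate-cancel _ (slice-pt a i) (κ g a) (slice-pt a j) ⟩
    trans (cong (slice a) (contraction (pt i))) (slice-pt a i) ∎

  inverse∘idMap : ∀ y → inverse (idMap C y) ≡ y
  inverse∘idMap = Colim.homotopy (inverse ∘ idMap C) id H λ g a → begin
    trans (cong (inverse ∘ idMap C) (κ g a)) (H _ a)
      ≡⟨ cong (λ r → trans r (H _ a)) (cong-∘ (κ g a)) ⟩
    trans (cong inverse (cong (idMap C) (κ g a))) (H _ a)
      ≡⟨ cong (λ r → trans (cong inverse r) (H _ a)) (Colim.idMap-κ g a) ⟩
    trans (cong inverse (trans (Colim.idMap-ι _ a) (sym (Colim.idMap-ι _ a)))) (H _ a)
      ≡⟨ cong-whisker-square inverse (Colim.idMap-ι _ a) (Colim.idMap-ι _ a)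
                             (inverse-to-ι-κ g a) ⟩
    trans (H _ a) (κ g a)
      ≡⟨ cong (trans (H _ a)) (sym (cong-id (κ g a))) ⟩
    trans (H _ a) (cong id (κ g a)) ∎
    where
    H : ∀ i a → inverse (idMap C (ι i a)) ≡ ι i a
    H i a = trans (cong inverse (Colim.idMap-ι i a)) (inverse-to-ι i a)

  idMap-isEquiv : isEquiv (idMap C)
  idMap-isEquiv = qinv⇒isEquiv (idMap C) inverse inverse∘idMap (λ a → idMap∘slice a centre)

mainTheorem13 : ∀ {ℓ : Level} (Γ : Graph ℓ) (R : Realization Γ) → isTree R →
                (A : Set ℓ) (C : ConstColim Γ A) → isEquiv (idMap C)
mainTheorem13 Γ R tree A C = idMap-isEquiv R tree C
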